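{- Let $q\geq 2$, $n\geq 0$ and $d\geq 0$ be integers. Then $A_q(n,d)\leq B_q(n,d)$.
   Context: Write $[m]=\{1,\ldots,m\}$. A code is a subset of $[q]^n$. For $v,w\in[q]^n$ the Hamming distance $d_H(v,w)$ is the number of $i\in[n]$ with $v_i\neq w_i$. The minimum distance of a code $C$ is the minimum of $d_H(v,w)$ over distinct $v,w\in C$ (a code with at most one element has no pairs, so it never counts as having minimum distance less than $d$). $A_q(n,d)$ is the maximum cardinality of a code in $[q]^n$ with minimum distance at least $d$. For $k\geq 0$ let $\mathcal{C}_k$ be the collection of subsets $C\subseteq[q]^n$ with $|C|\leq k$. For $x:\mathcal{C}_4\to\mathbb{R}$ let $M(x)$ be the $\mathcal{C}_2\times\mathcal{C}_2$ matrix with $M(x)_{C,C'}=x(C\cup C')$. Define $B_q(n,d)$ as the maximum of $\sum_{w\in[q]^n}x(\{w\})$ over all functions $x:\mathcal{C}_4\to\mathbb{R}_{\geq 0}$ such that (i) $x(\emptyset)=1$, (ii) $x(C)=0$ whenever $C$ has minimum distance less than $d$, and (iii) $M(x)$ is positive semidefinite. -}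

module Defs where

open import Data.Bool using (Bool; true; false; _∨_)
open import Data.Nat using (ℕ; zero; suc; _<_; _≤_)
open import Data.Fin using (Fin)
open import Data.Fin.Properties using () renaming (_≟_ to _≟ᶠ_)
open import Data.Vec using (Vec; []; _∷_)
open import Data.Vec.Properties using (≡-dec)
open import Data.List using (List; []; _∷_; map; concatMap; filter; length; foldr; _++_)
open import Data.Product using (Σ; _×_)
open import Data.Integer using (+_)
open import Data.Rational using (ℚ; _+_; _*_; 0ℚ; _/_) renaming (_≤_ to _≤ℚ_)
open import Relation.Binary.PropositionalEquality using (_≡_; _≢_)
open import Relation.Nullary.Decidable using (⌊_⌋; does)
open import Relation.Nullary using (Dec; yes; no)
open import Data.Empty using (⊥)
import Data.Fin as F
import Data.Bool as B
import Data.Nat as N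
import Data.Rational as Q

Word : ℕ → ℕ → Set
Word q n = Vec (Fin q) n

_≟w_ : ∀ {q n} → (v w : Word q n) → Dec (v ≡ w)
_≟w_ = ≡-dec _≟ᶠ_

-- Enumeration of all elements of [q]^n (each exactly once).
allFinList : (q : ℕ) → List (Fin q)
allFinList zero = []
allFinList (suc q) = F.zero ∷ map F.suc (allFinList q)

allWords : (q n : ℕ) → List (Word q n)
allWords q zero = [] ∷ []
allWords q (suc n) = concatMap (λ a → map (a ∷_) (allWords q n)) (allFinList q)

hamming : ∀ {q n} → Word q n → Word q n → ℕ
hamming [] [] = 0
hamming (a ∷ v) (b ∷ w) with a ≟ᶠ b
... | yes _ = hamming v w
... | no _ = suc (hamming v w)

WSet : ℕ → ℕ → Set
WSet q n = Word q n → Bool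

∅ : ∀ {q n} → WSet q n
∅ _ = false

⟦_⟧ : ∀ {q n} → Word q n → WSet q n
⟦ w ⟧ v = does (v ≟w w)

_∪_ : ∀ {q n} → WSet q n → WSet q n → WSet q n
(C ∪ C') w = C w ∨ C' w

card : ∀ {q n} → WSet q n → ℕ
card {q} {n} C = length (filter (λ w → C w B.≟ true) (allWords q n))

In𝒞 : ∀ {q n} → ℕ → WSet q n → Set
In𝒞 k C = card C ≤ k

MinDistLT : ∀ {q n} → WSet q n → ℕ → Set
MinDistLT {q} {n} C d =
  Σ (Word q n) λ v → Σ (Word q n) λ w →
    C v ≡ true × C w ≡ true × v ≢ w × hamming v w < d

MinDistGE : ∀ {q n} → WSet q n → ℕ → Set
MinDistGE C d = MinDistLT C d → ⊥

-- Enumeration of the collection 𝒞_2 (every subset of size ≤ 2 exactly once),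
-- via sublists of the duplicate-free list allWords.
sublists : ∀ {A : Set} → List A → List (List A)
sublists [] = [] ∷ []
sublists (a ∷ as) = let r = sublists as in r ++ map (a ∷_) r

listToSet : ∀ {q n} → List (Word q n) → WSet q n
listToSet [] _ = false
listToSet (u ∷ us) w = does (w ≟w u) ∨ listToSet us w

𝒞₂-list : (q n : ℕ) → List (WSet q n)
𝒞₂-list q n = map listToSet (filter (λ l → length l N.≤? 2) (sublists (allWords q n)))

sumℚ : ∀ {A : Set} → List A → (A → ℚ) → ℚ
sumℚ l f = foldr (λ a s → f a + s) 0ℚ l

M : ∀ {q n} → (WSet q n → ℚ) → WSet q n → WSet q n → ℚ
M x C C' = x (C ∪ C')

PSD : ∀ {q n} → (WSet q n → ℚ) → Set
PSD {q} {n} x = (y : WSet q n → ℚ) →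
  0ℚ ≤ℚ sumℚ (𝒞₂-list q n) (λ C → sumℚ (𝒞₂-list q n) (λ C' → y C * M x C C' * y C'))

Feasible : (q n d : ℕ) → (WSet q n → ℚ) → Set
Feasible q n d x =
  ((C : WSet q n) → In𝒞 4 C → 0ℚ ≤ℚ x C)
  × x ∅ ≡ Q.1ℚ
  × ((C : WSet q n) → In𝒞 4 C → MinDistLT C d → x C ≡ 0ℚ)
  × PSD x

objective : ∀ {q n} → (WSet q n → ℚ) → ℚ
objective {q} {n} x = sumℚ (allWords q n) (λ w → x ⟦ w ⟧)

ℕtoℚ : ℕ → ℚ
ℕtoℚ k = + k / 1

module Submission where

-- The witness is the indicator of "being a subset of C":
--     x(S) = 1 if S ⊆ C,   x(S) = 0 otherwise.
-- Since S ∪ T ⊆ C iff S ⊆ C and T ⊆ C, the function x is multiplicative,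
-- x(S ∪ T) = x(S) x(T); hence M(x) = x xᵀ is a rank-one matrix and its
-- quadratic form yᵀ M(x) y = (Σ_S x(S) y(S))² is nonnegative.  Nonnegativity
-- and x(∅) = 1 are immediate, and x vanishes on every set of minimum distance
-- < d, because such a set is not contained in the code C.  Finally
-- x({w}) = 1 for each of the |C| codewords w, so the objective is ≥ |C|.

open import Defs
open import Data.Nat using (ℕ; _≤_; suc)
open import Data.Product using (Σ; _×_; _,_)
open import Data.Bool using (Bool; true; false; _∧_; not; _∨_; if_then_else_; T)
import Data.Bool as Bool
open import Data.Bool.Properties using (T-≡; ∨-zeroʳ)
open import Data.List using (List; []; _∷_; map; filter; length)
open import Data.Bool.ListAction using (all)
open import Data.List.Membership.Propositional using (_∈_)
open import Data.List.Membership.Propositional.Properties using (∈-map⁺; ∈-concatMap⁺)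
open import Data.List.Relation.Unary.Any using (Any; here; there)
import Data.List.Relation.Unary.All as All
open import Data.List.Relation.Unary.All.Properties using (all⁺; all⁻)
open import Data.Vec using ([]; _∷_)
open import Data.Fin using (Fin)
import Data.Fin as Fin
open import Data.Integer using (+_)
import Data.Integer as ℤ
import Data.Integer.Properties as ℤ
open import Data.Rational using (ℚ; mkℚ; 0ℚ; 1ℚ; _+_; _*_; _/_) renaming (_≤_ to _≤ℚ_)
open import Data.Rational.Properties
open import Data.Rational.Solver using (module +-*-Solver)
open import Data.Nat.Coprimality using (1-coprimeTo)
import Data.Nat.Coprimality as Coprimality
open import Function using (Equivalence)
open import Relation.Binary.PropositionalEquality
open import Relation.Nullary using (yes; no)
open import Data.Empty using (⊥-elim)

sum-cong : ∀ {A : Set} (l : List A) {f g : A → ℚ} →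
  (∀ a → f a ≡ g a) → sumℚ l f ≡ sumℚ l g
sum-cong []      f≡g = refl
sum-cong (a ∷ l) f≡g = cong₂ _+_ (f≡g a) (sum-cong l f≡g)

sum-*ˡ : ∀ {A : Set} (l : List A) (f : A → ℚ) c →
  c * sumℚ l f ≡ sumℚ l (λ a → c * f a)
sum-*ˡ []      f c = *-zeroʳ c
sum-*ˡ (a ∷ l) f c =
  trans (*-distribˡ-+ c (f a) (sumℚ l f)) (cong (λ s → c * f a + s) (sum-*ˡ l f c))

sum-*ʳ : ∀ {A : Set} (l : List A) (f : A → ℚ) c →
  sumℚ l f * c ≡ sumℚ l (λ a → f a * c)
sum-*ʳ []      f c = *-zeroˡ c
sum-*ʳ (a ∷ l) f c =
  trans (*-distribʳ-+ c (f a) (sumℚ l f)) (cong (λ s → f a * c + s) (sum-*ʳ l f c))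

doubleSum-product : ∀ {A : Set} (l : List A) (f g : A → ℚ) →
  sumℚ l (λ a → sumℚ l (λ b → f a * g b)) ≡ sumℚ l f * sumℚ l g
doubleSum-product l f g = begin
  sumℚ l (λ a → sumℚ l (λ b → f a * g b)) ≡⟨ sum-cong l (λ a → sym (sum-*ˡ l g (f a))) ⟩
  sumℚ l (λ a → f a * sumℚ l g)           ≡⟨ sym (sum-*ʳ l f (sumℚ l g)) ⟩
  sumℚ l f * sumℚ l g                     ∎
  where open ≡-Reasoning

square-nonNeg : ∀ p → 0ℚ ≤ℚ p * p
square-nonNeg p@(mkℚ (+ _) _ _) =
  nonNegative⁻¹ (p * p) {{nonNeg*nonNeg⇒nonNeg p p}}
square-nonNeg p@(mkℚ ℤ.-[1+ _ ] _ _) =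
  nonNegative⁻¹ (p * p) {{nonPos*nonPos⇒nonPos p {{neg⇒nonPos p}} p {{neg⇒nonPos p}}}}

-- A rank-one matrix m(a,b) = f(a) f(b) is positive semidefinite: its quadratic
-- form is the square (Σ_a f(a) y(a))².
rankOne-quadraticForm-nonNeg : ∀ {A : Set} (l : List A) (m : A → A → ℚ) (f : A → ℚ) →
  (∀ a b → m a b ≡ f a * f b) →
  (y : A → ℚ) → 0ℚ ≤ℚ sumℚ l (λ a → sumℚ l (λ b → y a * m a b * y b))
rankOne-quadraticForm-nonNeg l m f m≡ff y =
  subst (0ℚ ≤ℚ_) (sym form≡square) (square-nonNeg (sumℚ l fy))
  where
  open +-*-Solver using (solve; _:*_; _:=_)
  fy : _ → ℚ
  fy a = f a * y a
  regroup : ∀ a b → y a * m a b * y b ≡ fy a * fy b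
  regroup a b = trans (cong (λ z → y a * z * y b) (m≡ff a b))
    (solve 4 (λ ya fa fb yb → ya :* (fa :* fb) :* yb := (fa :* ya) :* (fb :* yb))
      refl (y a) (f a) (f b) (y b))
  form≡square : sumℚ l (λ a → sumℚ l (λ b → y a * m a b * y b)) ≡ sumℚ l fy * sumℚ l fy
  form≡square = trans (sum-cong l (λ a → sum-cong l (regroup a))) (doubleSum-product l fy fy)

ℕtoℚ-suc : ∀ k → ℕtoℚ (suc k) ≡ 1ℚ + ℕtoℚ k
ℕtoℚ-suc k rewrite normalize-coprime (Coprimality.sym (1-coprimeTo k)) =
  cong (λ z → z / 1) (cong (λ z → + 1 ℤ.+ z) (sym (ℤ.*-identityʳ (+ k))))

count≤sum : ∀ {A : Set} (p : A → Bool) (f : A → ℚ) →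
  (∀ a → 0ℚ ≤ℚ f a) → (∀ a → p a ≡ true → f a ≡ 1ℚ) →
  (l : List A) → ℕtoℚ (length (filter (λ a → p a Bool.≟ true) l)) ≤ℚ sumℚ l f
count≤sum p f f≥0 f≡1 [] = ≤-refl
count≤sum p f f≥0 f≡1 (a ∷ l) with p a Bool.≟ true
... | yes pa = subst (_≤ℚ f a + sumℚ l f) (sym (ℕtoℚ-suc (length (filter (λ a → p a Bool.≟ true) l))))
                 (+-mono-≤ (≤-reflexive (sym (f≡1 a pa))) (count≤sum p f f≥0 f≡1 l))
... | no _   = subst (_≤ℚ f a + sumℚ l f) (+-identityˡ _)
                 (+-mono-≤ (f≥0 a) (count≤sum p f f≥0 f≡1 l))

allFinList-complete : ∀ {q} (i : Fin q) → i ∈ allFinList q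
allFinList-complete Fin.zero    = here refl
allFinList-complete (Fin.suc i) = there (∈-map⁺ Fin.suc (allFinList-complete i))

allWords-complete : ∀ {q n} (w : Word q n) → w ∈ allWords q n
allWords-complete []                = here refl
allWords-complete {q} {suc n} (a ∷ w) =
  ∈-concatMap⁺ (λ b → map (b ∷_) (allWords q n)) (prefixed (allFinList-complete a))
  where
  prefixed : ∀ {as} → a ∈ as → Any (λ b → (a ∷ w) ∈ map (b ∷_) (allWords q n)) as
  prefixed (here refl) = here (∈-map⁺ (a ∷_) (allWords-complete w))
  prefixed (there a∈) = there (prefixed a∈)

_⊆ᵇ_ : ∀ {q n} → WSet q n → WSet q n → Bool
_⊆ᵇ_ {q} {n} S C = all (λ w → not (S w) ∨ C w) (allWords q n)

⊆ᵇ-intro : ∀ {q n} (S C : WSet q n) → (∀ w → S w ≡ true → C w ≡ true) → S ⊆ᵇ C ≡ true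
⊆ᵇ-intro {q} {n} S C S⊆C =
  Equivalence.to T-≡ (all⁻ _ (All.universal pointwise (allWords q n)))
  where
  pointwise : ∀ w → T (not (S w) ∨ C w)
  pointwise w with S w in Sw
  ... | false = _
  ... | true  = Equivalence.from T-≡ (S⊆C w Sw)

⊆ᵇ-elim : ∀ {q n} (S C : WSet q n) → S ⊆ᵇ C ≡ true → ∀ w → S w ≡ true → C w ≡ true
⊆ᵇ-elim {q} {n} S C S⊆ᵇC w Sw
  with All.lookup (all⁺ _ (allWords q n) (Equivalence.from T-≡ S⊆ᵇC)) (allWords-complete w)
... | holds rewrite Sw = Equivalence.to T-≡ holds

⊆ᵇ-mono : ∀ {q n} (R S C : WSet q n) →
  (∀ w → R w ≡ true → S w ≡ true) → S ⊆ᵇ C ≡ true → R ⊆ᵇ C ≡ true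
⊆ᵇ-mono R S C R⊆S S⊆C = ⊆ᵇ-intro R C (λ w Rw → ⊆ᵇ-elim S C S⊆C w (R⊆S w Rw))

∪-⊆ᵇ : ∀ {q n} (S T C : WSet q n) → (S ∪ T) ⊆ᵇ C ≡ S ⊆ᵇ C ∧ T ⊆ᵇ C
∪-⊆ᵇ S T C with (S ∪ T) ⊆ᵇ C in S∪T⊆C | S ⊆ᵇ C in S⊆C | T ⊆ᵇ C in T⊆C
... | true  | true  | true  = refl
... | false | false | _     = refl
... | false | true  | false = refl
... | false | true  | true  = trans (sym S∪T⊆C) (⊆ᵇ-intro (S ∪ T) C both)
  where
  both : ∀ w → (S ∪ T) w ≡ true → C w ≡ true
  both w S∪Tw with S w in Sw
  ... | true  = ⊆ᵇ-elim S C S⊆C w Sw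
  ... | false = ⊆ᵇ-elim T C T⊆C w S∪Tw
... | true  | false | _     = trans (sym (⊆ᵇ-mono S (S ∪ T) C left S∪T⊆C)) S⊆C
  where
  left : ∀ w → S w ≡ true → (S ∪ T) w ≡ true
  left w Sw rewrite Sw = refl
... | true  | true  | false = trans (sym (⊆ᵇ-mono T (S ∪ T) C right S∪T⊆C)) T⊆C
  where
  right : ∀ w → T w ≡ true → (S ∪ T) w ≡ true
  right w Tw rewrite Tw = ∨-zeroʳ (S w)

boolToℚ : Bool → ℚ
boolToℚ b = if b then 1ℚ else 0ℚ

boolToℚ-nonNeg : ∀ b → 0ℚ ≤ℚ boolToℚ b
boolToℚ-nonNeg true  = nonNegative⁻¹ 1ℚ
boolToℚ-nonNeg false = ≤-refl

boolToℚ-∧ : ∀ a b → boolToℚ (a ∧ b) ≡ boolToℚ a * boolToℚ b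
boolToℚ-∧ true  b = sym (*-identityˡ (boolToℚ b))
boolToℚ-∧ false b = sym (*-zeroˡ (boolToℚ b))

subsetIndicator : ∀ {q n} → WSet q n → WSet q n → ℚ
subsetIndicator C S = boolToℚ (S ⊆ᵇ C)

-- x is multiplicative over unions, so M(x) = x xᵀ has rank one.
subsetIndicator-∪ : ∀ {q n} (C S T : WSet q n) →
  subsetIndicator C (S ∪ T) ≡ subsetIndicator C S * subsetIndicator C T
subsetIndicator-∪ C S T = trans (cong boolToℚ (∪-⊆ᵇ S T C)) (boolToℚ-∧ (S ⊆ᵇ C) (T ⊆ᵇ C))

subsetIndicator-psd : ∀ {q n} (C : WSet q n) → PSD (subsetIndicator C)
subsetIndicator-psd {q} {n} C =
  rankOne-quadraticForm-nonNeg (𝒞₂-list q n) (M (subsetIndicator C)) (subsetIndicator C)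
    (subsetIndicator-∪ C)

subsetIndicator-∅ : ∀ {q n} (C : WSet q n) → subsetIndicator C ∅ ≡ 1ℚ
subsetIndicator-∅ C = cong boolToℚ (⊆ᵇ-intro ∅ C (λ _ ()))

-- A set containing two close distinct words is not contained in a code of
-- minimum distance ≥ d, so x vanishes on it.
subsetIndicator-vanishes : ∀ {q n} (C : WSet q n) d → MinDistGE C d →
  (S : WSet q n) → MinDistLT S d → subsetIndicator C S ≡ 0ℚ
subsetIndicator-vanishes C d C-far S (v , w , Sv , Sw , v≢w , close) with S ⊆ᵇ C in S⊆C
... | false = refl
... | true  = ⊥-elim (C-far (v , w , ⊆ᵇ-elim S C S⊆C v Sv , ⊆ᵇ-elim S C S⊆C w Sw , v≢w , close))

subsetIndicator-codeword : ∀ {q n} (C : WSet q n) w → C w ≡ true →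
  subsetIndicator C ⟦ w ⟧ ≡ 1ℚ
subsetIndicator-codeword C w Cw = cong boolToℚ (⊆ᵇ-intro ⟦ w ⟧ C singleton⊆C)
  where
  singleton⊆C : ∀ v → ⟦ w ⟧ v ≡ true → C v ≡ true
  singleton⊆C v with v ≟w w
  ... | yes refl = λ _ → Cw
  ... | no _     = λ ()

subsetIndicator-feasible : ∀ {q n} (C : WSet q n) d → MinDistGE C d →
  Feasible q n d (subsetIndicator C)
subsetIndicator-feasible C d C-far =
    (λ S _ → boolToℚ-nonNeg (S ⊆ᵇ C))
  , subsetIndicator-∅ C
  , (λ S _ → subsetIndicator-vanishes C d C-far S)
  , subsetIndicator-psd C

card≤objective : ∀ {q n} (C : WSet q n) → ℕtoℚ (card C) ≤ℚ objective (subsetIndicator C)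
card≤objective {q} {n} C =
  count≤sum C (λ w → subsetIndicator C ⟦ w ⟧) (λ w → boolToℚ-nonNeg (⟦ w ⟧ ⊆ᵇ C))
    (subsetIndicator-codeword C) (allWords q n)

mainTheorem1 : (q n d : ℕ) → 2 ≤ q →
    (C : WSet q n) → MinDistGE C d →
    Σ (WSet q n → ℚ) λ x → Feasible q n d x × ℕtoℚ (card C) ≤ℚ objective x
mainTheorem1 q n d _ C C-far =
  subsetIndicator C , subsetIndicator-feasible C d C-far , card≤objective C
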